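{- Let $s$ be a non-leaping sequence, $G\in\mathrm{CP}(s)$ the graph of a neighborhood sequence $W_1,\ldots,W_n$ (with associated $a_k$), and $\mathcal{D}$ its distance matrix. For $k\ge 2$ let ${\bf d}=\mathcal{D}({\bf e}_k-{\bf e}_{a_k})$. Then for $h\le k$, ${\bf d}_h=1$ if $h<b_k$, ${\bf d}_h=0$ if $b_k\le h<k$, and ${\bf d}_h=-1$ if $h=k$.
   Context: A sequence of integers $q_1,\ldots,q_n$ ($n\ge 2$) is non-leaping if $q_1=0$, $q_2=1$, and $2\le q_k\le q_{k-1}+1$ for $k=3,\ldots,n$. Set $b_k=k-q_k+1$ for $k\ge 3$, and $a_2=1$, $b_2=2$. A neighborhood sequence is $W_1=\varnothing$, $W_2=\{1\}$, and for $k\ge3$, $W_k=\{a_k\}\cup\{b_k,\ldots,k-1\}$ where $a_k\in W_{k-1}$ and $a_k<b_k$. Its graph has vertex set $\{1,\ldots,n\}$ and edges $\{i,k\}$ for $i\in W_k$; $\mathrm{CP}(s)$ is the set of all such graphs. $\mathcal{D}=[\operatorname{dist}_G(i,j)]$, ${\bf e}_i$ are standard basis vectors, and ${\bf d}_h$ is the $h$-th entry. -}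

module Defs where

open import Data.Nat using (ℕ; zero; suc; _+_; _∸_; _≤_; _<_)
open import Data.Integer using (ℤ; +_; _-_)
open import Data.Product using (_×_)
open import Data.Sum using (_⊎_)
open import Data.Empty using (⊥)
open import Relation.Binary.PropositionalEquality using (_≡_)

-- Sequences are functions ℕ → ℕ, indexed from 1 (only indices 1..n matter).

record NonLeaping (n : ℕ) (q : ℕ → ℕ) : Set where
  field
    n≥2  : 2 ≤ n
    q1   : q 1 ≡ 0
    q2   : q 2 ≡ 1
    qlow : ∀ k → 3 ≤ k → k ≤ n → 2 ≤ q k
    qupp : ∀ k → 3 ≤ k → k ≤ n → q k ≤ q (k ∸ 1) + 1

-- b_k = k - q_k + 1  (for k = 2 this gives 2 - 1 + 1 = 2 = b_2 as in the paper)
b : (ℕ → ℕ) → ℕ → ℕ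
b q 2 = 2
b q k = (k + 1) ∸ q k

InW : (q a : ℕ → ℕ) → ℕ → ℕ → Set
InW q a zero i = ⊥
InW q a (suc zero) i = ⊥
InW q a (suc (suc zero)) i = i ≡ 1
InW q a k@(suc (suc (suc _))) i = i ≡ a k ⊎ (b q k ≤ i × i < k)

-- a : ℕ → ℕ gives the a_k of a neighborhood sequence W_1..W_n for s = q
record NbhdSeq (n : ℕ) (q a : ℕ → ℕ) : Set where
  field
    a2   : a 2 ≡ 1
    aInW : ∀ k → 3 ≤ k → k ≤ n → InW q a (k ∸ 1) (a k)
    a<b  : ∀ k → 3 ≤ k → k ≤ n → a k < b q k

Adj : (n : ℕ) (q a : ℕ → ℕ) → ℕ → ℕ → Set
Adj n q a x y = (y ≤ n × InW q a y x) ⊎ (x ≤ n × InW q a x y)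

data Walk (n : ℕ) (q a : ℕ → ℕ) : ℕ → ℕ → ℕ → Set where
  here : ∀ {x} → Walk n q a 0 x x
  step : ∀ {d x y z} → Adj n q a x y → Walk n q a d y z → Walk n q a (suc d) x z

IsDist : (n : ℕ) (q a : ℕ → ℕ) → ℕ → ℕ → ℕ → Set
IsDist n q a x y d = Walk n q a d x y × (∀ d' → d' < d → Walk n q a d' x y → ⊥)

-- entry h of D (e_k - e_{a_k}) given D(h,k) = d₁ and D(h,a_k) = d₂
colDiff : ℕ → ℕ → ℤ
colDiff d₁ d₂ = + d₁ - + d₂

-- W_{m+1} ⊆ W_m ∪ {m}, so every W_m is a clique and x ∈ W_m lies in each W_c with
-- x < c ≤ m.  Let h < b_k.  A walk from h to k first leaves {1, …, b_k − 1} along an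
-- edge v ~ y with y ≥ b_k; then v ∈ W_y, hence v ∈ W_{b_k} ∋ a_k, so the walk can be
-- cut to a strictly shorter walk from h to a_k.  As a_k ~ k this gives
-- dist(h,k) = dist(h,a_k) + 1.  For b_k ≤ h < k both h and a_k lie in the clique W_k
-- and are adjacent to k, and h = k is immediate.
module Submission where

open import Defs
open import Data.Nat using (ℕ; zero; suc; _+_; _∸_; _≤_; _<_; z≤n; s≤s; _≟_; _≤?_; _<?_)
open import Data.Nat.Properties
open import Data.Nat.Induction using (<-rec)
open import Data.Integer using (+_; -_)
open import Data.Integer.Properties using (m-n≡m⊖n; ⊖-≥)
open import Data.Product using (Σ; ∃; _×_; _,_; proj₁; proj₂)
open import Data.Sum using (_⊎_; inj₁; inj₂)
open import Data.Empty using (⊥; ⊥-elim)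
open import Relation.Binary using (tri<; tri≈; tri>)
open import Relation.Nullary using (Dec; yes; no)
open import Relation.Nullary.Decidable using (_×-dec_; _⊎-dec_)
open import Relation.Binary.PropositionalEquality
  using (_≡_; _≢_; refl; sym; trans; cong; subst; module ≡-Reasoning)

colDiff-suc : ∀ d → colDiff (suc d) d ≡ + 1
colDiff-suc d = begin
  colDiff (suc d) d  ≡⟨ m-n≡m⊖n (suc d) d ⟩
  suc d ⊖ d          ≡⟨ ⊖-≥ (n≤1+n d) ⟩
  + (suc d ∸ d)      ≡⟨ cong +_ (m+n∸n≡m 1 d) ⟩
  + 1                ∎
  where open ≡-Reasoning
        open Data.Integer using (_⊖_)

module LeastWitness {P : ℕ → Set} (P? : ∀ d → Dec (P d)) where

  Least : ℕ → Set
  Least d = P d × (∀ d′ → d′ < d → P d′ → ⊥)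

  least-witness : ∀ {L} → P L → ∃ Least
  least-witness {L} = <-rec (λ L → P L → ∃ Least) go L
    where
    go : ∀ L → (∀ {L′} → L′ < L → P L′ → ∃ Least) → P L → ∃ Least
    go L rec pL with anyUpTo? P? L
    ... | yes (L′ , L′<L , pL′) = rec L′<L pL′
    ... | no ¬smaller = L , pL , λ d′ d′<L pd′ → ¬smaller (d′ , d′<L , pd′)

interval⇒InW : ∀ {q a k x} → 2 ≤ k → b q k ≤ x → x < k → InW q a k x
interval⇒InW {k = suc zero} (s≤s ()) _ _
interval⇒InW {k = suc (suc zero)} _ b≤x x<k = ⊥-elim (<⇒≱ x<k b≤x)
interval⇒InW {k = suc (suc (suc _))} _ b≤x x<k = inj₂ (b≤x , x<k)

InW-dec : ∀ {q a : ℕ → ℕ} m x → Dec (InW q a m x)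
InW-dec zero _ = no λ ()
InW-dec (suc zero) _ = no λ ()
InW-dec (suc (suc zero)) x = x ≟ 1
InW-dec {q} {a} m@(suc (suc (suc _))) x = (x ≟ a m) ⊎-dec ((b q m ≤? x) ×-dec (x <? m))

module Walks {n : ℕ} {q a : ℕ → ℕ} where

  Walk-zero : ∀ {x y} → Walk n q a 0 x y → x ≡ y
  Walk-zero here = refl

  Walk-nonempty : ∀ {d x y} → x ≢ y → Walk n q a d x y → 0 < d
  Walk-nonempty x≢y here = ⊥-elim (x≢y refl)
  Walk-nonempty _ (step _ _) = s≤s z≤n

  Adj-dec : ∀ x y → Dec (Adj n q a x y)
  Adj-dec x y = ((y ≤? n) ×-dec InW-dec y x) ⊎-dec ((x ≤? n) ×-dec InW-dec x y)

  _▷_ : ∀ {d x y z} → Walk n q a d x y → Adj n q a y z → Walk n q a (suc d) x z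
  here       ▷ e = step e here
  step e′ w  ▷ e = step e′ (w ▷ e)

  _++_ : ∀ {d₁ d₂ x y z} → Walk n q a d₁ x y → Walk n q a d₂ y z → Walk n q a (d₁ + d₂) x z
  here     ++ w′ = w′
  step e w ++ w′ = step e (w ++ w′)

  reverse : ∀ {d x y} → Walk n q a d x y → Walk n q a d y x
  reverse here       = here
  reverse (step (inj₁ e) w) = reverse w ▷ inj₂ e
  reverse (step (inj₂ e) w) = reverse w ▷ inj₁ e

  IsDist-refl : ∀ {x} → IsDist n q a x x 0
  IsDist-refl = here , λ _ ()

  IsDist-adjacent : ∀ {x y} → x ≢ y → Adj n q a x y → IsDist n q a x y 1
  IsDist-adjacent x≢y e = step e here , λ { zero _ w → x≢y (Walk-zero w) ; (suc _) (s≤s ()) _ }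

module Bounds {n : ℕ} {q : ℕ → ℕ} (NL : NonLeaping n q) where
  open NonLeaping NL

  q<k : ∀ k → 2 ≤ k → k ≤ n → q k < k
  q<k (suc zero) (s≤s ()) _
  q<k (suc (suc zero)) _ _ rewrite q2 = ≤-refl
  q<k (suc (suc (suc j))) _ k≤n = begin-strict
    q (3 + j)        ≤⟨ qupp (3 + j) (s≤s (s≤s (s≤s z≤n))) k≤n ⟩
    q (2 + j) + 1    <⟨ +-monoˡ-< 1 (q<k (suc (suc j)) (s≤s (s≤s z≤n)) (≤-trans (n≤1+n _) k≤n)) ⟩
    (2 + j) + 1      ≡⟨ +-comm (2 + j) 1 ⟩
    3 + j            ∎
    where open ≤-Reasoning

  2≤b : ∀ k → 2 ≤ k → k ≤ n → 2 ≤ b q k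
  2≤b (suc zero) (s≤s ()) _
  2≤b (suc (suc zero)) _ _ = ≤-refl
  2≤b k@(suc (suc (suc _))) 2≤k k≤n =
    m+n≤o⇒m≤o∸n 2 (subst (suc (suc (q k)) ≤_) (+-comm 1 k) (s≤s (q<k k 2≤k k≤n)))

  b<k : ∀ k → 3 ≤ k → k ≤ n → b q k < k
  b<k (suc zero) (s≤s ()) _
  b<k (suc (suc zero)) (s≤s (s≤s ())) _
  b<k k@(suc (suc (suc j))) 3≤k k≤n = begin-strict
    (k + 1) ∸ q k    ≤⟨ ∸-monoʳ-≤ (k + 1) (qlow k 3≤k k≤n) ⟩
    (k + 1) ∸ 2      ≡⟨ cong suc (+-comm j 1) ⟩
    2 + j            <⟨ ≤-refl ⟩
    k                ∎
    where open ≤-Reasoning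

  b≤k : ∀ k → 2 ≤ k → k ≤ n → b q k ≤ k
  b≤k (suc zero) (s≤s ()) _
  b≤k (suc (suc zero)) _ _ = ≤-refl
  b≤k k@(suc (suc (suc _))) _ k≤n = <⇒≤ (b<k k (s≤s (s≤s (s≤s z≤n))) k≤n)

  b-mono : ∀ k → 2 ≤ k → suc k ≤ n → b q k ≤ b q (suc k)
  b-mono (suc zero) (s≤s ()) _
  b-mono (suc (suc zero)) _ 3≤n = 2≤b 3 (s≤s (s≤s z≤n)) 3≤n
  b-mono k@(suc (suc (suc _))) _ k+1≤n = begin
    (k + 1) ∸ q k              ≡⟨ cong (suc k + 1 ∸_) (+-comm 1 (q k)) ⟩
    (suc k + 1) ∸ (q k + 1)    ≤⟨ ∸-monoʳ-≤ (suc k + 1) (qupp (suc k) (s≤s (s≤s (s≤s z≤n))) k+1≤n) ⟩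
    (suc k + 1) ∸ q (suc k)    ∎
    where open ≤-Reasoning

module Neighbourhoods {n : ℕ} {q a : ℕ → ℕ} (NL : NonLeaping n q) (NS : NbhdSeq n q a) where
  open Bounds NL public
  open Walks {n} {q} {a}
  open NbhdSeq NS

  W : ℕ → ℕ → Set
  W = InW q a

  a∈W : ∀ k → 2 ≤ k → W k (a k)
  a∈W (suc zero) (s≤s ())
  a∈W (suc (suc zero)) _ = a2
  a∈W (suc (suc (suc _))) _ = inj₁ refl

  InW-< : ∀ {m x} → m ≤ n → W m x → x < m
  InW-< {suc (suc zero)} _ refl = ≤-refl
  InW-< {m@(suc (suc (suc _)))} m≤n (inj₁ refl) =
    <-≤-trans (a<b m (s≤s (s≤s (s≤s z≤n))) m≤n) (b≤k m (s≤s (s≤s z≤n)) m≤n)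
  InW-< {suc (suc (suc _))} _ (inj₂ (_ , x<m)) = x<m

  InW-suc : ∀ {m x} → 2 ≤ m → suc m ≤ n → W (suc m) x → W m x ⊎ x ≡ m
  InW-suc {suc zero} (s≤s ()) _ _
  InW-suc {suc (suc j)} _ m+1≤n (inj₁ refl) = inj₁ (aInW (3 + j) (s≤s (s≤s (s≤s z≤n))) m+1≤n)
  InW-suc {m@(suc (suc _))} 2≤m m+1≤n (inj₂ (b≤x , x<m+1)) with m≤n⇒m<n∨m≡n (≤-pred x<m+1)
  ... | inj₂ x≡m = inj₂ x≡m
  ... | inj₁ x<m = inj₁ (interval⇒InW 2≤m (≤-trans (b-mono m 2≤m m+1≤n) b≤x) x<m)

  InW-down : ∀ {c m x} → 2 ≤ c → c ≤ m → m ≤ n → W m x → x < c → W c x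
  InW-down {c} {m} 2≤c c≤m m≤n w x<c with m≤n⇒m<n∨m≡n c≤m
  ... | inj₂ refl = w
  InW-down {m = suc m} 2≤c _ m+1≤n w x<c | inj₁ (s≤s c≤m) with InW-suc (≤-trans 2≤c c≤m) m+1≤n w
  ... | inj₁ w′ = InW-down {m = m} 2≤c c≤m (≤-trans (n≤1+n m) m+1≤n) w′ x<c
  ... | inj₂ refl = ⊥-elim (<⇒≱ x<c c≤m)

  InW-pos : ∀ {m x} → m ≤ n → W m x → 1 ≤ x
  InW-pos {x = suc _} _ _ = s≤s z≤n
  -- 0 ∈ W_m would put 0 into W₂ = {1}
  InW-pos {suc (suc m)} {zero} m≤n w with InW-down ≤-refl (s≤s (s≤s z≤n)) m≤n w (s≤s z≤n)
  ... | ()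

  InW-lower : ∀ {m x z} → m ≤ n → W m x → W m z → x < z → z ≤ n × W z x
  InW-lower m≤n wx wz x<z =
    <⇒≤ (<-≤-trans (InW-< m≤n wz) m≤n) ,
    InW-down (≤-trans (s≤s (InW-pos m≤n wx)) x<z) (<⇒≤ (InW-< m≤n wz)) m≤n wx x<z

  InW-clique : ∀ {m x z} → m ≤ n → W m x → W m z → x ≢ z → Adj n q a x z
  InW-clique {x = x} {z} m≤n wx wz x≢z with <-cmp x z
  ... | tri< x<z _ _ = inj₁ (InW-lower m≤n wx wz x<z)
  ... | tri≈ _ x≡z _ = ⊥-elim (x≢z x≡z)
  ... | tri> _ _ z<x = inj₂ (InW-lower m≤n wz wx z<x)

  a∈W-b : ∀ k → 2 ≤ k → k ≤ n → W (b q k) (a k)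
  a∈W-b (suc zero) (s≤s ()) _
  a∈W-b (suc (suc zero)) _ _ = a2
  a∈W-b k@(suc (suc (suc _))) 2≤k k≤n =
    InW-down (2≤b k 2≤k k≤n) (≤-pred (b<k k 3≤k k≤n)) (≤-trans (n≤1+n _) k≤n)
      (aInW k 3≤k k≤n) (a<b k 3≤k k≤n)
    where
    3≤k : 3 ≤ k
    3≤k = s≤s (s≤s (s≤s z≤n))

  InW-below-b : ∀ {k x} → 2 ≤ k → W k x → x < b q k → x ≡ a k
  InW-below-b {suc zero} (s≤s ()) _ _
  InW-below-b {suc (suc zero)} _ x≡1 _ = trans x≡1 (sym a2)
  InW-below-b {suc (suc (suc _))} _ (inj₁ x≡a) _ = x≡a
  InW-below-b {suc (suc (suc _))} _ (inj₂ (b≤x , _)) x<b = ⊥-elim (<⇒≱ x<b b≤x)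

  Adj-upward : ∀ {x y} → Adj n q a x y → x < y → y ≤ n × W y x
  Adj-upward (inj₁ p) _ = p
  Adj-upward (inj₂ (x≤n , w)) x<y = ⊥-elim (<-asym x<y (InW-< x≤n w))

  Adj-bounded : ∀ {x y} → Adj n q a x y → y ≤ n
  Adj-bounded (inj₁ (y≤n , _)) = y≤n
  Adj-bounded (inj₂ (x≤n , w)) = <⇒≤ (<-≤-trans (InW-< x≤n w) x≤n)

  Walk-dec : ∀ d x y → Dec (Walk n q a d x y)
  Walk-dec zero x y with x ≟ y
  ... | yes refl = yes here
  ... | no x≢y = no λ w → x≢y (Walk-zero w)
  Walk-dec (suc d) x y with anyUpTo? (λ z → Adj-dec x z ×-dec Walk-dec d z y) (suc n)
  ... | yes (_ , _ , e , w) = yes (step e w)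
  ... | no ¬via = no λ { (step e w) → ¬via (_ , s≤s (Adj-bounded e) , e , w) }

  IsDist-from-Walk : ∀ {L x y} → Walk n q a L x y → ∃ (IsDist n q a x y)
  IsDist-from-Walk {x = x} {y} = least-witness
    where open LeastWitness (λ d → Walk-dec d x y)

  walk-to-1 : ∀ v → 1 ≤ v → v ≤ n → ∃ λ L → Walk n q a L v 1
  walk-to-1 = <-rec (λ v → 1 ≤ v → v ≤ n → ∃ λ L → Walk n q a L v 1) go
    where
    go : ∀ v → (∀ {u} → u < v → 1 ≤ u → u ≤ n → ∃ λ L → Walk n q a L u 1) →
         1 ≤ v → v ≤ n → ∃ λ L → Walk n q a L v 1
    go (suc zero) _ _ _ = 0 , here
    go v@(suc (suc _)) rec _ v≤n =
      let L , w = rec av<v (InW-pos v≤n av∈W) (≤-trans (<⇒≤ av<v) v≤n)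
      in suc L , step (inj₂ (v≤n , av∈W)) w
      where
      av∈W : W v (a v)
      av∈W = a∈W v (s≤s (s≤s z≤n))
      av<v : a v < v
      av<v = InW-< v≤n av∈W

  connected : ∀ {x y} → 1 ≤ x → x ≤ n → 1 ≤ y → y ≤ n → ∃ λ L → Walk n q a L x y
  connected {x} {y} 1≤x x≤n 1≤y y≤n =
    let L₁ , w₁ = walk-to-1 x 1≤x x≤n
        L₂ , w₂ = walk-to-1 y 1≤y y≤n
    in L₁ + L₂ , w₁ ++ reverse w₂

  a<b-2≤k : ∀ k → 2 ≤ k → k ≤ n → a k < b q k
  a<b-2≤k k 2≤k k≤n = InW-< (≤-trans (b≤k k 2≤k k≤n) k≤n) (a∈W-b k 2≤k k≤n)

  shortcut : ∀ k → 2 ≤ k → k ≤ n → ∀ {L v} → Walk n q a L v k → v < b q k →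
             ∃ λ L′ → L′ < L × Walk n q a L′ v (a k)
  shortcut k 2≤k k≤n here k<b = ⊥-elim (<⇒≱ k<b (b≤k k 2≤k k≤n))
  shortcut k 2≤k k≤n {v = v} (step {y = y} e w) v<b with y <? b q k
  ... | yes y<b = let L′ , L′<L , w′ = shortcut k 2≤k k≤n w y<b in suc L′ , s≤s L′<L , step e w′
  ... | no y≮b with v ≟ a k
  ...   | yes refl = 0 , s≤s z≤n , here
  ...   | no v≢a = 1 , s≤s (Walk-nonempty y≢k w) , step v~a here
    where
    b≤y : b q k ≤ y
    b≤y = ≮⇒≥ y≮b
    upward : y ≤ n × W y v
    upward = Adj-upward e (<-≤-trans v<b b≤y)
    v∈Wy : W y v
    v∈Wy = proj₂ upward
    y≢k : y ≢ k
    y≢k refl = v≢a (InW-below-b 2≤k v∈Wy v<b)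
    v~a : Adj n q a v (a k)
    v~a = InW-clique (≤-trans (b≤k k 2≤k k≤n) k≤n)
            (InW-down (2≤b k 2≤k k≤n) b≤y (proj₁ upward) v∈Wy v<b) (a∈W-b k 2≤k k≤n) v≢a

  dist-below-b : ∀ {k h} → 2 ≤ k → k ≤ n → 1 ≤ h → h < b q k →
                 Σ ℕ λ d → IsDist n q a h k (suc d) × IsDist n q a h (a k) d
  dist-below-b {k} {h} 2≤k k≤n 1≤h h<b =
    let L , w = connected 1≤h h≤n (≤-trans (s≤s z≤n) 2≤k) k≤n
        d , w₂ , minimal = IsDist-from-Walk (w ▷ inj₂ a~k)
    in d , (w₂ ▷ inj₁ a~k , λ d′ d′<1+d w′ →
             let L′ , L′<d′ , w″ = shortcut k 2≤k k≤n w′ h<b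
             in minimal L′ (<-≤-trans L′<d′ (≤-pred d′<1+d)) w″) ,
           (w₂ , minimal)
    where
    h≤n : h ≤ n
    h≤n = ≤-trans (<⇒≤ (<-≤-trans h<b (b≤k k 2≤k k≤n))) k≤n
    a~k : k ≤ n × W k (a k)
    a~k = k≤n , a∈W k 2≤k

  dist-from-b : ∀ {k h} → 2 ≤ k → k ≤ n → b q k ≤ h → h < k →
                IsDist n q a h k 1 × IsDist n q a h (a k) 1
  dist-from-b {k} {h} 2≤k k≤n b≤h h<k =
    IsDist-adjacent (<⇒≢ h<k) (inj₁ (k≤n , h∈W)) ,
    IsDist-adjacent h≢a (InW-clique k≤n h∈W (a∈W k 2≤k) h≢a)
    where
    h∈W : W k h
    h∈W = interval⇒InW 2≤k b≤h h<k
    h≢a : h ≢ a k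
    h≢a = >⇒≢ (<-≤-trans (a<b-2≤k k 2≤k k≤n) b≤h)

  dist-at-k : ∀ {k} → 2 ≤ k → k ≤ n → IsDist n q a k k 0 × IsDist n q a k (a k) 1
  dist-at-k {k} 2≤k k≤n =
    IsDist-refl , IsDist-adjacent (>⇒≢ (InW-< k≤n (a∈W k 2≤k))) (inj₂ (k≤n , a∈W k 2≤k))

lemma2p10 : (n : ℕ) (q a : ℕ → ℕ) → NonLeaping n q → NbhdSeq n q a →
    (k h : ℕ) → 2 ≤ k → k ≤ n → 1 ≤ h → h ≤ k →
    Σ ℕ λ d₁ → Σ ℕ λ d₂ → IsDist n q a h k d₁ × IsDist n q a h (a k) d₂ ×
      ((h < b q k → colDiff d₁ d₂ ≡ + 1) ×
       (b q k ≤ h → h < k → colDiff d₁ d₂ ≡ + 0) ×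
       (h ≡ k → colDiff d₁ d₂ ≡ - (+ 1)))
lemma2p10 n q a NL NS k h 2≤k k≤n 1≤h h≤k with h <? b q k
... | yes h<b =
  let d , dist-k , dist-a = dist-below-b 2≤k k≤n 1≤h h<b
  in suc d , d , dist-k , dist-a ,
     (λ _ → colDiff-suc d) ,
     (λ b≤h _ → ⊥-elim (<⇒≱ h<b b≤h)) ,
     (λ h≡k → ⊥-elim (<⇒≢ (<-≤-trans h<b (b≤k k 2≤k k≤n)) h≡k))
  where open Neighbourhoods NL NS
... | no h≮b with m≤n⇒m<n∨m≡n h≤k
...   | inj₁ h<k =
  let dist-k , dist-a = dist-from-b 2≤k k≤n (≮⇒≥ h≮b) h<k
  in 1 , 1 , dist-k , dist-a ,
     (λ h<b → ⊥-elim (h≮b h<b)) , (λ _ _ → refl) , (λ h≡k → ⊥-elim (<⇒≢ h<k h≡k))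
  where open Neighbourhoods NL NS
...   | inj₂ refl =
  let dist-k , dist-a = dist-at-k 2≤k k≤n
  in 0 , 1 , dist-k , dist-a ,
     (λ h<b → ⊥-elim (h≮b h<b)) , (λ _ h<h → ⊥-elim (<-irrefl refl h<h)) , (λ _ → refl)
  where open Neighbourhoods NL NS
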